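{- Let $S=\{x_1,x_2,\ldots,x_m\}$ be a gcd-closed set of distinct positive integers indexed so that $i\le j$ whenever $x_i\mid x_j$. Let $U=[S](S)^{ -1}$. Let $x_n\in S$ and write $D_n\cup\{x_n\}=\{x_n=x_{n_1},\ldots,x_{n_t}\}$. Then for each $1\le q\le m$, $$\sum_{i=1}^{t}U_{q n_i}=\sum_{s=1}^{m}[x_q,x_s]\,\frac{c_{sn}}{\alpha_n}.$$
   Context: $\mu$ is the Möbius function, $\varphi$ Euler's totient function, $[a,b]$ the lcm. $S$ is gcd-closed if $\gcd(x,y)\in S$ for all $x,y\in S$. The GCD matrix $(S)$ has $(i,j)$-entry $\gcd(x_i,x_j)$ (it is invertible for such $S$) and the LCM matrix $[S]$ has $(i,j)$-entry $[x_i,x_j]$. $D_n=\{x\in S: x_n\mid x,\ x>x_n\}$. For $x_i,x_j\in S$, $c_{ij}=\sum\mu(d)$ over positive integers $d$ with $dx_i\mid x_j$ and $dx_i\nmid x_k$ for every $x_k\in S$ with $x_k<x_j$; and $\alpha_n=\sum\varphi(d)$ over positive integers $d$ with $d\mid x_n$ and $d\nmid x_k$ for every $x_k\in S$ with $x_k<x_n$. -}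

module Defs where

open import Data.Bool using (Bool; true; false; if_then_else_; _∧_; _∨_; not)
open import Data.Nat as ℕ using (ℕ; zero; suc; _<_; _<?_)
open import Data.Nat.Divisibility using (_∣_; _∣?_)
open import Data.Nat.GCD using (gcd)
open import Data.Nat.LCM using (lcm)
open import Data.Nat.Primality using (prime?)
open import Data.Integer as ℤ using (ℤ; +_; -[1+_])
open import Data.Rational as ℚ using (ℚ; _/_)
open import Data.Fin using (Fin; zero; suc)
open import Data.Fin.Properties using () renaming (_≟_ to _≟F_)
open import Data.List using (List; map; upTo; filter; length; foldr)
open import Relation.Nullary using (does)
open import Relation.Binary.PropositionalEquality using (_≡_)
open import Data.Product using (∃-syntax)

oneTo : ℕ → List ℕ
oneTo n = map suc (upTo n)

sumIfℤ : (ℕ → Bool) → (ℕ → ℤ) → List ℕ → ℤ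
sumIfℤ P f = foldr (λ d acc → if P d then f d ℤ.+ acc else acc) (+ 0)

sumIfℕ : (ℕ → Bool) → (ℕ → ℕ) → List ℕ → ℕ
sumIfℕ P f = foldr (λ d acc → if P d then f d ℕ.+ acc else acc) 0

-- Möbius function (μ 0 is irrelevant and set to 0):
-- μ(n) = 0 if p² ∣ n for some prime p, and (-1)^k otherwise,
-- where k is the number of distinct primes dividing n.
μ : ℕ → ℤ
μ zero = + 0
μ n@(suc _) =
  if squarefull then + 0 else (-[1+ 0 ] ℤ.^ k)
  where
  squarefull : Bool
  squarefull = foldr _∨_ false
    (map (λ p → does (prime? p) ∧ does ((p ℕ.* p) ∣? n)) (oneTo n))
  k : ℕ
  k = sumIfℕ (λ p → does (prime? p) ∧ does (p ∣? n)) (λ _ → 1) (oneTo n)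

φ : ℕ → ℕ
φ n = sumIfℕ (λ k → does (gcd k n ℕ.≟ 1)) (λ _ → 1) (oneTo n)

ΣF : ∀ {m} → (Fin m → ℚ) → ℚ
ΣF {zero} f = ℚ.0ℚ
ΣF {suc m} f = f zero ℚ.+ ΣF (λ i → f (suc i))

allF : ∀ {m} → (Fin m → Bool) → Bool
allF {zero} f = true
allF {suc m} f = f zero ∧ allF (λ i → f (suc i))

ℕtoℚ : ℕ → ℚ
ℕtoℚ n = (+ n) / 1

ℤtoℚ : ℤ → ℚ
ℤtoℚ z = z / 1

-- division of a rational by a natural number (only used with a
-- positive divisor; the value for divisor 0 is an irrelevant default)
_÷ℕ_ : ℚ → ℕ → ℚ
p ÷ℕ zero = ℚ.0ℚ
p ÷ℕ (suc k) = p ℚ.* ((+ 1) / suc k)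

-- S = {x_0, ..., x_{m-1}} given by x : Fin m → ℕ  (indices 0-based)

-- c_{ij} = Σ μ(d) over d ≥ 1 with d x_i ∣ x_j and d x_i ∤ x_k for every
-- x_k ∈ S with x_k < x_j.  (Such d satisfy d ≤ x_j since x_j > 0.)
c : ∀ {m} → (Fin m → ℕ) → Fin m → Fin m → ℤ
c x i j = sumIfℤ cond μ (oneTo (x j))
  where
  cond : ℕ → Bool
  cond d = does ((d ℕ.* x i) ∣? x j)
         ∧ allF (λ k → not (does (x k <? x j)) ∨ not (does ((d ℕ.* x i) ∣? x k)))

α : ∀ {m} → (Fin m → ℕ) → Fin m → ℕ
α x n = sumIfℕ cond φ (oneTo (x n))
  where
  cond : ℕ → Bool
  cond d = does (d ∣? x n)
         ∧ allF (λ k → not (does (x k <? x n)) ∨ not (does (d ∣? x k)))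

Mat : ℕ → Set
Mat m = Fin m → Fin m → ℚ

_·_ : ∀ {m} → Mat m → Mat m → Mat m
(A · B) i j = ΣF (λ k → A i k ℚ.* B k j)

I : ∀ {m} → Mat m
I i j = if does (i ≟F j) then ℚ.1ℚ else ℚ.0ℚ

gcdMat : ∀ {m} → (Fin m → ℕ) → Mat m
gcdMat x i j = ℕtoℚ (gcd (x i) (x j))

lcmMat : ∀ {m} → (Fin m → ℕ) → Mat m
lcmMat x i j = ℕtoℚ (lcm (x i) (x j))

GcdClosed : ∀ {m} → (Fin m → ℕ) → Set
GcdClosed {m} x = ∀ (i j : Fin m) → ∃[ k ] x k ≡ gcd (x i) (x j)

-- Let ζ be the divisibility matrix of S, ζ_lj = [x_l ∣ x_j], and C = (c_kl).
-- Grouping divisors d by the least element of S that d divides, Gauss's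
-- identity ∑_{d ∣ g} φ(d) = g yields the structure theorem (S) = ζᵀ·diag(α)·ζ,
-- and Möbius's identity ∑_{d ∣ N} μ(d) = [N = 1] yields C·ζ = I.  As C is
-- unitriangular with respect to divisibility it is injective, so ζ·C = I as
-- well, whence (S)·C = ζᵀ·diag(α).  Column n of this identity says that
-- w_s = c_sn / α_n solves (S)·w = ζₙ, ζₙ = ([x_n ∣ x_j])_j.  The left side of
-- the lemma is ([S]·(S)⁻¹·ζₙ)_q = ([S]·w)_q, the right side.  (Only the
-- identity (S)⁻¹·(S) = I is used, and not the ordering of the indices.)

module Submission where

open import Defs
open import Data.Nat using (ℕ; _<_; _≤_)
open import Data.Nat.Divisibility using (_∣_)
open import Data.Nat.LCM using (lcm)
open import Data.Fin using (Fin) renaming (_≤_ to _≤F_)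
open import Data.Bool using (if_then_else_)
open import Data.Rational using (ℚ; 0ℚ; _*_)
open import Data.Nat.Divisibility using (_∣?_)
open import Relation.Nullary using (does)
open import Relation.Binary.PropositionalEquality using (_≡_)
open import Function.Definitions using (Injective)

open import Algebra.Bundles using (Semiring; CommutativeRing)
open import Data.Bool using (Bool; true; false; _∧_; _∨_; not; T)
open import Data.Bool.ListAction using (any)
open import Data.Bool.Properties using (T-∧)
open import Data.Empty using (⊥-elim)
open import Data.Fin using (zero; suc; punchIn)
open import Data.Fin.Properties using (punchInᵢ≢i) renaming (_≟_ to _≟F_)
open import Data.Integer as ℤ using (ℤ; +_; -[1+_])
import Data.Integer.Properties as ℤP
open import Algebra.Properties.AbelianGroup ℤP.+-0-abelianGroup using (∙-cancelʳ)
open import Algebra.Properties.CommutativeSemigroup ℤP.+-commutativeSemigroup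
  using () renaming (interchange to +-interchange)
open import Data.List using (List; []; _∷_; map; upTo; foldr; _++_; _∷ʳ_)
import Data.List.Properties as ListP
open import Data.List.Membership.Propositional using (_∈_)
open import Data.List.Membership.Propositional.Properties using (∈-map⁺; ∈-upTo⁺)
open import Data.List.Relation.Unary.All using (_∷_)
open import Data.List.Relation.Unary.Any as Any using (here; there)
open import Data.List.Relation.Unary.Any.Properties using (any⁺; any⁻)
open import Data.Nat as ℕ using (zero; suc; z≤n; s≤s; _≟_; _<?_)
open import Data.Nat.Coprimality using (Coprime; coprime-divisor)
open import Data.Nat.Divisibility
  using ( divides; ∣-antisym; ∣-trans; ∣-refl; ∣⇒≤; m*n∣⇒n∣; m∣m*n; n∣m*n; ∣n⇒∣m*n
        ; *-monoʳ-∣; *-monoˡ-∣; *-cancelˡ-∣; *-cancelʳ-∣)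
open import Data.Nat.GCD
  using (gcd; gcd-zeroˡ; gcd[m,n]∣m; gcd[m,n]∣n; gcd-greatest; gcd[m,n]≡0⇒m≡0; c*gcd[m,n]≡gcd[cm,cn])
open import Data.Nat.Primality using (Prime; prime?; euclidsLemma; prime⇒irreducible; prime⇒nonZero; prime⇒nonTrivial)
open import Data.Nat.Primality.Factorisation using (factorise)
import Data.Nat.Properties as ℕP
open import Data.Product using (Σ; _×_; _,_; proj₁; proj₂)
import Data.Rational as ℚ
import Data.Rational.Properties as ℚP
open import Data.Sum using (_⊎_; inj₁; inj₂)
open import Data.Unit using (tt)
open import Function.Base using (_∘_)
open import Function.Bundles using (Equivalence)
open import Relation.Nullary using (¬_; Dec; yes; no)
open import Relation.Nullary.Decidable using (dec-true; dec-false; T?)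
open import Relation.Binary.PropositionalEquality
  using (_≢_; refl; sym; trans; cong; cong₂; subst; module ≡-Reasoning)
import Relation.Binary.Reasoning.Setoid

from-does : ∀ {A : Set} (a? : Dec A) → T (does a?) → A
from-does (yes a) _ = a

to-does : ∀ {A : Set} (a? : Dec A) → A → T (does a?)
to-does (yes _) _ = tt
to-does (no ¬a) a = ¬a a

does-cong : ∀ {A B : Set} (a? : Dec A) (b? : Dec B) → (A → B) → (B → A) → does a? ≡ does b?
does-cong (yes a) b? A→B B→A = sym (dec-true b? (A→B a))
does-cong (no ¬a) b? A→B B→A = sym (dec-false b? (λ b → ¬a (B→A b)))

T-ext : ∀ {b c} → (T b → T c) → (T c → T b) → b ≡ c
T-ext {true}  {true}  _   _   = refl
T-ext {true}  {false} b⇒c _   = ⊥-elim (b⇒c tt)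
T-ext {false} {true}  _   c⇒b = ⊥-elim (c⇒b tt)
T-ext {false} {false} _   _   = refl

¬T⇒≡false : ∀ {b} → ¬ T b → b ≡ false
¬T⇒≡false {true}  ¬b = ⊥-elim (¬b tt)
¬T⇒≡false {false} _  = refl

allF-elim : ∀ {m} (f : Fin m → Bool) → T (allF f) → ∀ i → T (f i)
allF-elim f all zero    = proj₁ (Equivalence.to T-∧ all)
allF-elim f all (suc i) = allF-elim (λ i → f (suc i)) (proj₂ (Equivalence.to T-∧ all)) i

allF-intro : ∀ {m} (f : Fin m → Bool) → (∀ i → T (f i)) → T (allF f)
allF-intro {zero}  f each = tt
allF-intro {suc m} f each = Equivalence.from T-∧ (each zero , allF-intro (λ i → f (suc i)) (λ i → each (suc i)))

allF-counterexample : ∀ {m} (f : Fin m → Bool) → ¬ T (allF f) → Σ (Fin m) λ i → ¬ T (f i)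
allF-counterexample {zero}  f notAll = ⊥-elim (notAll tt)
allF-counterexample {suc m} f notAll with T? (f zero)
... | no ¬f₀ = zero , ¬f₀
... | yes f₀ with allF-counterexample (λ i → f (suc i)) (λ all → notAll (Equivalence.from T-∧ (f₀ , all)))
...   | i , ¬fᵢ = suc i , ¬fᵢ

implies-not-intro : ∀ {A B : Set} (a? : Dec A) (b? : Dec B) → (A → ¬ B) → T (not (does a?) ∨ not (does b?))
implies-not-intro (no _)  _       A⇒¬B = tt
implies-not-intro (yes _) (no _)  A⇒¬B = tt
implies-not-intro (yes a) (yes b) A⇒¬B = A⇒¬B a b

implies-not-elim : ∀ {A B : Set} (a? : Dec A) (b? : Dec B) → T (not (does a?) ∨ not (does b?)) → A → ¬ B
implies-not-elim (no ¬a) _        holds a b = ¬a a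
implies-not-elim (yes _) (no ¬b)  holds a b = ¬b b

implies-not-fails : ∀ {A B : Set} (a? : Dec A) (b? : Dec B) → ¬ T (not (does a?) ∨ not (does b?)) → A × B
implies-not-fails (yes a) (yes b) fails = a , b
implies-not-fails (no _)  _       fails = ⊥-elim (fails tt)
implies-not-fails (yes _) (no _)  fails = ⊥-elim (fails tt)

module SemiringSums {c ℓ} (R : Semiring c ℓ) where
  open Semiring R using (Carrier; _≈_; _+_; 0#; +-cong; +-congˡ; +-identityˡ; +-identityʳ; setoid)
    renaming (refl to ≈-refl; trans to ≈-trans)
  open import Algebra.Properties.Semiring.Sum R public
  open import Relation.Binary.Reasoning.Setoid setoid

  sum-zero : ∀ {n} (f : Fin n → Carrier) → (∀ i → f i ≈ 0#) → sum f ≈ 0#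
  sum-zero {zero} f z = ≈-refl
  sum-zero {suc n} f z =
    ≈-trans (+-cong (z zero) (sum-zero (λ i → f (suc i)) (λ i → z (suc i)))) (+-identityˡ 0#)

  sum-single : ∀ {n} (f : Fin n → Carrier) (i₀ : Fin n) →
               (∀ i → i ≢ i₀ → f i ≈ 0#) → sum f ≈ f i₀
  sum-single f zero z = begin
    f zero + sum (λ i → f (suc i)) ≈⟨ +-congˡ (sum-zero _ (λ i → z (suc i) (λ ()))) ⟩
    f zero + 0#                    ≈⟨ +-identityʳ (f zero) ⟩
    f zero                         ∎
  sum-single f (suc i₀) z = begin
    f zero + sum (λ i → f (suc i))
      ≈⟨ +-cong (z zero (λ ())) (sum-single _ i₀ (λ i i≢i₀ → z (suc i) (λ { refl → i≢i₀ refl }))) ⟩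
    0# + f (suc i₀)                ≈⟨ +-identityˡ (f (suc i₀)) ⟩
    f (suc i₀)                     ∎

module Matrices {c ℓ} (R : Semiring c ℓ) where
  open Semiring R using (Carrier; _≈_; 0#; 1#; *-assoc; *-identityʳ; *-identityˡ; zeroʳ; zeroˡ; *-cong; setoid)
    renaming (_*_ to _∙_; refl to ≈-refl; trans to ≈-trans; sym to ≈-sym; reflexive to ≈-reflexive)
  open SemiringSums R using (sum; sum-cong-≋; ∑-comm; *-distribˡ-sum; *-distribʳ-sum; sum-single)
  open import Relation.Binary.Reasoning.Setoid setoid

  Matrix : ℕ → Set c
  Matrix m = Fin m → Fin m → Carrier

  Vec : ℕ → Set c
  Vec m = Fin m → Carrier

  𝟙 : ∀ {m} → Matrix m
  𝟙 i j = if does (i ≟F j) then 1# else 0#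

  𝟙-diag : ∀ {m} (i : Fin m) → 𝟙 i i ≡ 1#
  𝟙-diag i rewrite dec-true (i ≟F i) refl = refl

  _⊗_ : ∀ {m} → Matrix m → Matrix m → Matrix m
  (A ⊗ B) i j = sum (λ k → A i k ∙ B k j)

  _⊛_ : ∀ {m} → Matrix m → Vec m → Vec m
  (A ⊛ v) i = sum (λ k → A i k ∙ v k)

  ⊛-cong : ∀ {m} {A B : Matrix m} {u v : Vec m} →
           (∀ i j → A i j ≈ B i j) → (∀ k → u k ≈ v k) → ∀ i → (A ⊛ u) i ≈ (B ⊛ v) i
  ⊛-cong A≈B u≈v i = sum-cong-≋ (λ k → *-cong (A≈B i k) (u≈v k))

  ⊛-assoc : ∀ {m} (A B : Matrix m) (v : Vec m) i → (A ⊛ (B ⊛ v)) i ≈ ((A ⊗ B) ⊛ v) i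
  ⊛-assoc A B v i = begin
    sum (λ k → A i k ∙ sum (λ j → B k j ∙ v j))   ≈⟨ sum-cong-≋ (λ k → *-distribˡ-sum (A i k) (λ j → B k j ∙ v j)) ⟩
    sum (λ k → sum (λ j → A i k ∙ (B k j ∙ v j))) ≈⟨ ∑-comm (λ k j → A i k ∙ (B k j ∙ v j)) ⟩
    sum (λ j → sum (λ k → A i k ∙ (B k j ∙ v j)))
      ≈⟨ sum-cong-≋ (λ j → sum-cong-≋ (λ k → ≈-sym (*-assoc (A i k) (B k j) (v j)))) ⟩
    sum (λ j → sum (λ k → (A i k ∙ B k j) ∙ v j)) ≈⟨ sum-cong-≋ (λ j → ≈-sym (*-distribʳ-sum (v j) (λ k → A i k ∙ B k j))) ⟩
    sum (λ j → (A ⊗ B) i j ∙ v j)                 ∎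

  ⊛-column : ∀ {m} (A : Matrix m) n i → (A ⊛ (λ k → 𝟙 k n)) i ≈ A i n
  ⊛-column A n i = ≈-trans (sum-single _ n off) (≈-trans (*-cong ≈-refl (≈-reflexive (𝟙-diag n))) (*-identityʳ (A i n)))
    where
    off : ∀ k → k ≢ n → A i k ∙ 𝟙 k n ≈ 0#
    off k k≢n rewrite dec-false (k ≟F n) k≢n = zeroʳ (A i k)

  𝟙-⊛ : ∀ {m} (v : Vec m) i → (𝟙 ⊛ v) i ≈ v i
  𝟙-⊛ v i = ≈-trans (sum-single _ i off) (≈-trans (*-cong (≈-reflexive (𝟙-diag i)) ≈-refl) (*-identityˡ (v i)))
    where
    off : ∀ k → k ≢ i → 𝟙 i k ∙ v k ≈ 0#
    off k k≢i rewrite dec-false (i ≟F k) (λ i≡k → k≢i (sym i≡k)) = zeroˡ (v k)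

  left-inverse-solves : ∀ {m} (V G : Matrix m) (w b : Vec m) →
    (∀ i j → (V ⊗ G) i j ≈ 𝟙 i j) → (∀ j → (G ⊛ w) j ≈ b j) → ∀ k → (V ⊛ b) k ≈ w k
  left-inverse-solves V G w b VG≈𝟙 Gw≈b k = begin
    (V ⊛ b) k        ≈⟨ ⊛-cong {A = V} (λ _ _ → ≈-refl) (λ j → ≈-sym (Gw≈b j)) k ⟩
    (V ⊛ (G ⊛ w)) k  ≈⟨ ⊛-assoc V G w k ⟩
    ((V ⊗ G) ⊛ w) k  ≈⟨ ⊛-cong VG≈𝟙 (λ _ → ≈-refl) k ⟩
    (𝟙 ⊛ w) k        ≈⟨ 𝟙-⊛ w k ⟩
    w k              ∎

module ℤSum = SemiringSums ℤP.+-*-semiring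
module ℚSum = SemiringSums (CommutativeRing.semiring ℚP.+-*-commutativeRing)
module ℤMat = Matrices ℤP.+-*-semiring
module ℚMat = Matrices (CommutativeRing.semiring ℚP.+-*-commutativeRing)
open ℤMat using (𝟙; _⊗_; _⊛_; ⊛-cong; ⊛-assoc; ⊛-column; 𝟙-⊛)
open ℤSum using (sum; sum-cong-≗; ∑-distrib-+; *-distribˡ-sum; *-distribʳ-sum)
  renaming (sum-zero to ℤsum-zero; sum-single to ℤsum-single)

sumTo : ℕ → (ℕ → ℤ) → ℤ
sumTo zero    f = + 0
sumTo (suc N) f = sumTo N f ℤ.+ f (suc N)

when : Bool → ℤ → ℤ
when b v = if b then v else + 0

module _ {A : Set} (a? : Dec A) (v : ℤ) where
  when-yes : A → when (does a?) v ≡ v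
  when-yes a rewrite dec-true a? a = refl

  when-no : ¬ A → when (does a?) v ≡ + 0
  when-no ¬a rewrite dec-false a? ¬a = refl

when-T : ∀ {b} {v} → T b → when b v ≡ v
when-T {true} _ = refl

when-*ˡ : ∀ b v w → when b v ℤ.* w ≡ v ℤ.* when b w
when-*ˡ true  v w = refl
when-*ˡ false v w = sym (ℤP.*-zeroʳ v)

when-1 : ∀ b v → v ℤ.* when b (+ 1) ≡ when b v
when-1 true  v = ℤP.*-identityʳ v
when-1 false v = ℤP.*-zeroʳ v

when-0 : ∀ b → when b (+ 0) ≡ + 0
when-0 true  = refl
when-0 false = refl

when-neg : ∀ b v → when b (ℤ.- v) ≡ ℤ.- when b v
when-neg true  v = refl
when-neg false v = refl

sumTo-cong : ∀ N {f g : ℕ → ℤ} → (∀ d → 1 ≤ d → d ≤ N → f d ≡ g d) → sumTo N f ≡ sumTo N g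
sumTo-cong zero    f≗g = refl
sumTo-cong (suc N) f≗g =
  cong₂ ℤ._+_ (sumTo-cong N (λ d 1≤d d≤N → f≗g d 1≤d (ℕP.m≤n⇒m≤1+n d≤N)))
              (f≗g (suc N) (s≤s z≤n) ℕP.≤-refl)

sumTo-zero : ∀ N (f : ℕ → ℤ) → (∀ d → 1 ≤ d → d ≤ N → f d ≡ + 0) → sumTo N f ≡ + 0
sumTo-zero zero    f z = refl
sumTo-zero (suc N) f z =
  cong₂ ℤ._+_ (sumTo-zero N f (λ d 1≤d d≤N → z d 1≤d (ℕP.m≤n⇒m≤1+n d≤N))) (z (suc N) (s≤s z≤n) ℕP.≤-refl)

sumTo-+ : ∀ N (f g : ℕ → ℤ) → sumTo N (λ d → f d ℤ.+ g d) ≡ sumTo N f ℤ.+ sumTo N g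
sumTo-+ zero    f g = refl
sumTo-+ (suc N) f g =
  trans (cong (ℤ._+ (f (suc N) ℤ.+ g (suc N))) (sumTo-+ N f g)) (+-interchange (sumTo N f) _ _ _)

sumTo-*ˡ : ∀ N a (f : ℕ → ℤ) → a ℤ.* sumTo N f ≡ sumTo N (λ d → a ℤ.* f d)
sumTo-*ˡ zero    a f = ℤP.*-zeroʳ a
sumTo-*ˡ (suc N) a f =
  trans (ℤP.*-distribˡ-+ a (sumTo N f) (f (suc N))) (cong (ℤ._+ (a ℤ.* f (suc N))) (sumTo-*ˡ N a f))

sumTo-sum : ∀ N {m} (f : ℕ → Fin m → ℤ) → sumTo N (λ d → sum (f d)) ≡ sum (λ i → sumTo N (λ d → f d i))
sumTo-sum zero {m} f = sym (ℤsum-zero {m} _ (λ i → refl))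
sumTo-sum (suc N) f =
  trans (cong (ℤ._+ sum (f (suc N))) (sumTo-sum N f)) (sym (∑-distrib-+ (λ i → sumTo N (λ d → f d i)) (f (suc N))))

sumTo-comm : ∀ N M (f : ℕ → ℕ → ℤ) → sumTo N (λ d → sumTo M (f d)) ≡ sumTo M (λ e → sumTo N (λ d → f d e))
sumTo-comm zero    M f = sym (sumTo-zero M _ (λ _ _ _ → refl))
sumTo-comm (suc N) M f =
  trans (cong (ℤ._+ sumTo M (f (suc N))) (sumTo-comm N M f)) (sym (sumTo-+ M _ (f (suc N))))

sumTo-const : ∀ N → sumTo N (λ _ → + 1) ≡ + N
sumTo-const zero    = refl
sumTo-const (suc N) = trans (cong (ℤ._+ + 1) (sumTo-const N)) (cong +_ (ℕP.+-comm N 1))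

sumTo-cutoff : ∀ N M (f : ℕ → ℤ) → (∀ d → N < d → d ≤ M → f d ≡ + 0) → N ≤ M → sumTo M f ≡ sumTo N f
sumTo-cutoff N zero    f z z≤n = refl
sumTo-cutoff N (suc M) f z N≤1+M with ℕP.m≤n⇒m<n∨m≡n N≤1+M
... | inj₂ refl       = refl
... | inj₁ (s≤s N≤M) = trans
  (cong₂ ℤ._+_ (sumTo-cutoff N M f (λ d N<d d≤M → z d N<d (ℕP.m≤n⇒m≤1+n d≤M)) N≤M)
               (z (suc M) (s≤s N≤M) ℕP.≤-refl))
  (ℤP.+-identityʳ _)

sumTo-single : ∀ N (f : ℕ → ℤ) t → 1 ≤ t → t ≤ N → (∀ d → d ≢ t → f d ≡ + 0) → sumTo N f ≡ f t
sumTo-single zero    f t () z≤n z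
sumTo-single (suc N) f t 1≤t t≤1+N z with ℕP.m≤n⇒m<n∨m≡n t≤1+N
... | inj₂ refl =
  trans (cong (ℤ._+ f t) (sumTo-zero N f (λ d _ d≤N → z d (λ { refl → ℕP.<-irrefl refl (s≤s d≤N) }))))
        (ℤP.+-identityˡ _)
... | inj₁ (s≤s t≤N) =
  trans (cong₂ ℤ._+_ (sumTo-single N f t 1≤t t≤N z) (z (suc N) (λ { refl → ℕP.<-irrefl refl (s≤s t≤N) })))
        (ℤP.+-identityʳ _)

sumTo-multiples : ∀ a d (F : ℕ → ℤ) .{{_ : ℕ.NonZero a}} → (∀ e → ¬ (a ∣ e) → F e ≡ + 0) →
                  sumTo (d ℕ.* a) F ≡ sumTo d (λ k → F (k ℕ.* a))
sumTo-multiples a zero F off = refl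
sumTo-multiples a@(suc a′) (suc d) F off = begin
  sumTo (suc d ℕ.* a) F
    ≡⟨ cong (λ t → sumTo t F) (trans (ℕP.+-comm a (d ℕ.* a)) (ℕP.+-suc (d ℕ.* a) a′)) ⟩
  sumTo (d ℕ.* a ℕ.+ a′) F ℤ.+ F (suc (d ℕ.* a ℕ.+ a′))
    ≡⟨ cong₂ ℤ._+_ gap (cong F (trans (sym (ℕP.+-suc (d ℕ.* a) a′)) (ℕP.+-comm (d ℕ.* a) a))) ⟩
  sumTo (d ℕ.* a) F ℤ.+ F (suc d ℕ.* a)
    ≡⟨ cong (ℤ._+ F (suc d ℕ.* a)) (sumTo-multiples a d F off) ⟩
  sumTo (suc d) (λ k → F (k ℕ.* a)) ∎
  where
  open ≡-Reasoning
  -- no multiple of a lies strictly between d·a and d·a + a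
  gap : sumTo (d ℕ.* a ℕ.+ a′) F ≡ sumTo (d ℕ.* a) F
  gap = sumTo-cutoff _ _ F (λ e lo hi → off e (nonMultiple e lo hi)) (ℕP.m≤m+n _ a′)
    where
    nonMultiple : ∀ e → d ℕ.* a < e → e ≤ d ℕ.* a ℕ.+ a′ → ¬ (a ∣ e)
    nonMultiple e lo hi (divides q refl) = ℕP.<⇒≱ below (ℕP.≤-trans (ℕP.*-monoˡ-≤ a d<q) hi)
      where
      d<q : d < q
      d<q = ℕP.*-cancelʳ-< a d q lo
      below : d ℕ.* a ℕ.+ a′ < suc d ℕ.* a
      below = subst (_< suc d ℕ.* a) (ℕP.+-comm a′ (d ℕ.* a)) (ℕP.n<1+n (a′ ℕ.+ d ℕ.* a))

oneTo-∷ʳ : ∀ N → oneTo (suc N) ≡ oneTo N ∷ʳ suc N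
oneTo-∷ʳ N = trans (cong (map suc) (sym (ListP.upTo-∷ʳ N))) (ListP.map-++ suc (upTo N) (N ∷ []))

∈-oneTo : ∀ {d N} → 1 ≤ d → d ≤ N → d ∈ oneTo N
∈-oneTo {suc d} (s≤s z≤n) d<N = ∈-map⁺ suc (∈-upTo⁺ d<N)

sumIfℤ-from : ∀ P f (l : List ℕ) b →
  foldr (λ d acc → if P d then f d ℤ.+ acc else acc) b l ≡ sumIfℤ P f l ℤ.+ b
sumIfℤ-from P f []      b = sym (ℤP.+-identityˡ b)
sumIfℤ-from P f (d ∷ l) b with P d
... | true  = trans (cong (ℤ._+_ (f d)) (sumIfℤ-from P f l b)) (sym (ℤP.+-assoc (f d) _ b))
... | false = sumIfℤ-from P f l b

sumIfℤ≡sumTo : ∀ P f N → sumIfℤ P f (oneTo N) ≡ sumTo N (λ d → when (P d) (f d))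
sumIfℤ≡sumTo P f zero    = refl
sumIfℤ≡sumTo P f (suc N) = begin
  sumIfℤ P f (oneTo (suc N))               ≡⟨ cong (sumIfℤ P f) (oneTo-∷ʳ N) ⟩
  foldr step (+ 0) (oneTo N ++ suc N ∷ []) ≡⟨ ListP.foldr-++ step (+ 0) (oneTo N) (suc N ∷ []) ⟩
  foldr step (step (suc N) (+ 0)) (oneTo N) ≡⟨ sumIfℤ-from P f (oneTo N) _ ⟩
  sumIfℤ P f (oneTo N) ℤ.+ step (suc N) (+ 0)
    ≡⟨ cong₂ ℤ._+_ (sumIfℤ≡sumTo P f N) (lastTerm (P (suc N))) ⟩
  sumTo (suc N) (λ d → when (P d) (f d)) ∎
  where
  open ≡-Reasoning
  step : ℕ → ℤ → ℤ
  step d acc = if P d then f d ℤ.+ acc else acc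
  lastTerm : ∀ b → (if b then f (suc N) ℤ.+ + 0 else + 0) ≡ when b (f (suc N))
  lastTerm true  = ℤP.+-identityʳ _
  lastTerm false = refl

sumIfℕ≡sumIfℤ : ∀ P f (l : List ℕ) → + sumIfℕ P f l ≡ sumIfℤ P (λ d → + f d) l
sumIfℕ≡sumIfℤ P f []      = refl
sumIfℕ≡sumIfℤ P f (d ∷ l) with P d
... | true  = cong (ℤ._+_ (+ f d)) (sumIfℕ≡sumIfℤ P f l)
... | false = sumIfℕ≡sumIfℤ P f l

term≤sumIfℕ : ∀ P f {l : List ℕ} {d} → d ∈ l → T (P d) → f d ≤ sumIfℕ P f l
term≤sumIfℕ P f (here {x = d} refl) Pd with P d
... | true = ℕP.m≤m+n (f d) _
term≤sumIfℕ P f (there {x = e} d∈l) Pd with P e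
... | true  = ℕP.≤-trans (term≤sumIfℕ P f d∈l Pd) (ℕP.m≤n+m _ (f e))
... | false = term≤sumIfℕ P f d∈l Pd

sumIfℕ≡sumTo : ∀ P f N → + sumIfℕ P f (oneTo N) ≡ sumTo N (λ d → when (P d) (+ f d))
sumIfℕ≡sumTo P f N = trans (sumIfℕ≡sumIfℤ P f (oneTo N)) (sumIfℤ≡sumTo P (λ d → + f d) N)

nonZero-factorˡ : ∀ {g} q G .{{_ : ℕ.NonZero g}} → g ≡ q ℕ.* G → ℕ.NonZero q
nonZero-factorˡ {g} zero G g≡0 = ⊥-elim (ℕ.≢-nonZero⁻¹ g g≡0)
nonZero-factorˡ (suc q) G _    = _

nonZero-factorʳ : ∀ {g} q G .{{_ : ℕ.NonZero g}} → g ≡ q ℕ.* G → ℕ.NonZero G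
nonZero-factorʳ q G g≡q*G = nonZero-factorˡ G q (trans g≡q*G (ℕP.*-comm q G))

-- Every k ∈ 1‥g is counted once,
-- under its cofactor d = g / gcd(k, g), and for d ∣ g exactly φ(d) of the
-- k have cofactor d, namely k = j·(g/d) with gcd(j, d) = 1.

φ≡sumTo : ∀ d → + φ d ≡ sumTo d (λ j → when (does (gcd j d ≟ 1)) (+ 1))
φ≡sumTo d = sumIfℕ≡sumTo (λ j → does (gcd j d ≟ 1)) (λ _ → 1) d

-- φ(N) ≥ 1, as k = 1 is counted
φ-pos : ∀ N .{{_ : ℕ.NonZero N}} → 1 ≤ φ N
φ-pos N = term≤sumIfℕ (λ j → does (gcd j N ≟ 1)) (λ _ → 1) (∈-oneTo ℕP.≤-refl (ℕ.>-nonZero⁻¹ N))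
  (to-does (gcd 1 N ≟ 1) (gcd-zeroˡ N))

isCofactor : ℕ → ℕ → ℕ → ℤ
isCofactor g d k = when (does (d ℕ.* gcd k g ≟ g)) (+ 1)

cofactor-unique : ∀ g k .{{_ : ℕ.NonZero g}} → sumTo g (λ d → isCofactor g d k) ≡ + 1
cofactor-unique g k with gcd[m,n]∣n k g
... | divides q g≡q*G =
  trans (sumTo-single g _ q (ℕ.>-nonZero⁻¹ q) q≤g others) (when-yes (q ℕ.* G ≟ g) (+ 1) (sym g≡q*G))
  where
  G = gcd k g
  instance
    q≢0 : ℕ.NonZero q
    q≢0 = nonZero-factorˡ q G g≡q*G
    G≢0 : ℕ.NonZero G
    G≢0 = nonZero-factorʳ q G g≡q*G
  q≤g : q ≤ g
  q≤g = subst (q ≤_) (sym g≡q*G) (ℕP.m≤m*n q G)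
  others : ∀ d → d ≢ q → isCofactor g d k ≡ + 0
  others d d≢q = when-no (d ℕ.* G ≟ g) (+ 1) (λ dG≡g → d≢q (ℕP.*-cancelʳ-≡ d q G (trans dG≡g g≡q*G)))

module _ {g d a : ℕ} .{{_ : ℕ.NonZero d}} .{{_ : ℕ.NonZero a}} (g≡d*a : g ≡ d ℕ.* a) where
  cofactor⇒gcd≡a : ∀ G → d ℕ.* G ≡ g → G ≡ a
  cofactor⇒gcd≡a G dG≡g = ℕP.*-cancelˡ-≡ G a d (trans dG≡g g≡d*a)

  gcd-multiple : ∀ j → gcd (j ℕ.* a) g ≡ a ℕ.* gcd j d
  gcd-multiple j = begin
    gcd (j ℕ.* a) g         ≡⟨ cong₂ gcd (ℕP.*-comm j a) (trans g≡d*a (ℕP.*-comm d a)) ⟩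
    gcd (a ℕ.* j) (a ℕ.* d) ≡⟨ c*gcd[m,n]≡gcd[cm,cn] a j d ⟨
    a ℕ.* gcd j d           ∎
    where open ≡-Reasoning

  cofactor-of-multiple : ∀ j → does (d ℕ.* gcd (j ℕ.* a) g ≟ g) ≡ does (gcd j d ≟ 1)
  cofactor-of-multiple j = does-cong (d ℕ.* gcd (j ℕ.* a) g ≟ g) (gcd j d ≟ 1) coprime⇐ coprime⇒
    where
    open ≡-Reasoning
    coprime⇐ : d ℕ.* gcd (j ℕ.* a) g ≡ g → gcd j d ≡ 1
    coprime⇐ e = ℕP.*-cancelˡ-≡ (gcd j d) 1 a
      (trans (sym (gcd-multiple j)) (trans (cofactor⇒gcd≡a _ e) (sym (ℕP.*-identityʳ a))))
    coprime⇒ : gcd j d ≡ 1 → d ℕ.* gcd (j ℕ.* a) g ≡ g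
    coprime⇒ e = begin
      d ℕ.* gcd (j ℕ.* a) g ≡⟨ cong (d ℕ.*_) (trans (gcd-multiple j) (cong (a ℕ.*_) e)) ⟩
      d ℕ.* (a ℕ.* 1)       ≡⟨ cong (d ℕ.*_) (ℕP.*-identityʳ a) ⟩
      d ℕ.* a               ≡⟨ g≡d*a ⟨
      g                     ∎

-- the k ∈ 1‥g with cofactor d are the multiples j·(g/d) with gcd(j, d) = 1
cofactor-count : ∀ g d .{{_ : ℕ.NonZero d}} .{{_ : ℕ.NonZero g}} →
                 sumTo g (isCofactor g d) ≡ when (does (d ∣? g)) (+ φ d)
cofactor-count g d with d ∣? g
... | no d∤g = sumTo-zero g _ (λ k _ _ → when-no (d ℕ.* gcd k g ≟ g) (+ 1)
        (λ dG≡g → d∤g (divides (gcd k g) (trans (sym dG≡g) (ℕP.*-comm d _)))))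
... | yes (divides a g≡a*d) = begin
  sumTo g (isCofactor g d)               ≡⟨ cong (λ t → sumTo t (isCofactor g d)) g≡d*a ⟩
  sumTo (d ℕ.* a) (isCofactor g d)       ≡⟨ sumTo-multiples a d (isCofactor g d) nonMultiple ⟩
  sumTo d (λ j → isCofactor g d (j ℕ.* a))
    ≡⟨ sumTo-cong d (λ j _ _ → cong (λ b → when b (+ 1)) (cofactor-of-multiple g≡d*a j)) ⟩
  sumTo d (λ j → when (does (gcd j d ≟ 1)) (+ 1)) ≡⟨ φ≡sumTo d ⟨
  + φ d                                  ∎
  where
  open ≡-Reasoning
  g≡d*a : g ≡ d ℕ.* a
  g≡d*a = trans g≡a*d (ℕP.*-comm a d)
  instance
    a≢0 : ℕ.NonZero a
    a≢0 = nonZero-factorˡ a d g≡a*d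
  nonMultiple : ∀ k → ¬ (a ∣ k) → isCofactor g d k ≡ + 0
  nonMultiple k a∤k = when-no (d ℕ.* gcd k g ≟ g) (+ 1)
    (λ dG≡g → a∤k (subst (_∣ k) (cofactor⇒gcd≡a g≡d*a _ dG≡g) (gcd[m,n]∣m k g)))

gauss : ∀ g .{{_ : ℕ.NonZero g}} → sumTo g (λ d → when (does (d ∣? g)) (+ φ d)) ≡ + g
gauss g = begin
  sumTo g (λ d → when (does (d ∣? g)) (+ φ d))
    ≡⟨ sumTo-cong g (λ d 1≤d _ → cofactor-count g d {{ℕ.>-nonZero 1≤d}}) ⟨
  sumTo g (λ d → sumTo g (isCofactor g d)) ≡⟨ sumTo-comm g g (isCofactor g) ⟩
  sumTo g (λ k → sumTo g (λ d → isCofactor g d k)) ≡⟨ sumTo-cong g (λ k _ _ → cofactor-unique g k) ⟩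
  sumTo g (λ _ → + 1)                      ≡⟨ sumTo-const g ⟩
  + g                                      ∎
  where open ≡-Reasoning

prime≢1 : ∀ {q} → Prime q → q ≢ 1
prime≢1 q-prime = ℕ.nonTrivial⇒≢1 {{prime⇒nonTrivial q-prime}}

prime∣prime⇒≡ : ∀ {q p} → Prime q → Prime p → q ∣ p → q ≡ p
prime∣prime⇒≡ q-prime p-prime q∣p with prime⇒irreducible p-prime q∣p
... | inj₁ q≡1 = ⊥-elim (prime≢1 q-prime q≡1)
... | inj₂ q≡p = q≡p

∤prime⇒coprime : ∀ {p m} → Prime p → ¬ (p ∣ m) → Coprime m p
∤prime⇒coprime p-prime p∤m (d∣m , d∣p) with prime⇒irreducible p-prime d∣p
... | inj₁ d≡1 = d≡1
... | inj₂ refl = ⊥-elim (p∤m d∣m)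

prime∣p*e⇒∣e : ∀ {q p e} → Prime q → Prime p → q ≢ p → q ∣ p ℕ.* e → q ∣ e
prime∣p*e⇒∣e {e = e} q-prime p-prime q≢p q∣pe with euclidsLemma _ e q-prime q∣pe
... | inj₁ q∣p = ⊥-elim (q≢p (prime∣prime⇒≡ q-prime p-prime q∣p))
... | inj₂ q∣e = q∣e

primeFactor : ∀ N → 2 ≤ N → Σ ℕ λ p → Prime p × Σ ℕ λ M → N ≡ p ℕ.* M
primeFactor (suc zero) (s≤s ())
primeFactor N@(suc (suc _)) _ with factorise N
... | record { factors = p ∷ rest ; isFactorisation = N≡∏ ; factorsPrime = p-prime ∷ _ } =
  p , p-prime , _ , N≡∏

squarefull : ℕ → Bool
squarefull n = any (λ p → does (prime? p) ∧ does ((p ℕ.* p) ∣? n)) (oneTo n)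

primeCount : ℕ → ℕ
primeCount n = sumIfℕ (λ p → does (prime? p) ∧ does (p ∣? n)) (λ _ → 1) (oneTo n)

μ-value : Bool → ℕ → ℤ
μ-value sq k = if sq then + 0 else -[1+ 0 ] ℤ.^ k

μ-value-suc : ∀ sq k → μ-value sq (suc k) ≡ ℤ.- μ-value sq k
μ-value-suc true  k = refl
μ-value-suc false k = ℤP.-1*i≡-i _

μ-unfold : ∀ n .{{_ : ℕ.NonZero n}} → μ n ≡ μ-value (squarefull n) (primeCount n)
μ-unfold (suc n) = refl

primeSquareDivides : ℕ → ℕ → Bool
primeSquareDivides n p = does (prime? p) ∧ does ((p ℕ.* p) ∣? n)

squarefull-intro : ∀ {p n} .{{_ : ℕ.NonZero n}} → Prime p → p ℕ.* p ∣ n → T (squarefull n)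
squarefull-intro {p} {n} p-prime pp∣n =
  any⁺ (primeSquareDivides n) (Any.map (λ { refl → holds }) (∈-oneTo 1≤p p≤n))
  where
  instance _ = prime⇒nonZero p-prime
  1≤p = ℕ.>-nonZero⁻¹ p
  p≤n = ℕP.≤-trans (ℕP.m≤m*n p p) (∣⇒≤ pp∣n)
  holds : T (primeSquareDivides n p)
  holds = Equivalence.from T-∧ (to-does (prime? p) p-prime , to-does ((p ℕ.* p) ∣? n) pp∣n)

squarefull-elim : ∀ {n} → T (squarefull n) → Σ ℕ λ p → Prime p × p ℕ.* p ∣ n
squarefull-elim {n} sq = p , from-does (prime? p) (proj₁ holds) , from-does ((p ℕ.* p) ∣? n) (proj₂ holds)
  where
  witness = Any.satisfied (any⁻ (primeSquareDivides n) (oneTo n) sq)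
  p = proj₁ witness
  holds : T (does (prime? p)) × T (does ((p ℕ.* p) ∣? n))
  holds = Equivalence.to T-∧ (proj₂ witness)

μ-squarefull : ∀ n .{{_ : ℕ.NonZero n}} → T (squarefull n) → μ n ≡ + 0
μ-squarefull n@(suc _) sq with squarefull n
... | true = refl

isPrimeFactor : ℕ → ℕ → ℤ
isPrimeFactor n q = when (does (prime? q) ∧ does (q ∣? n)) (+ 1)

primeCount≡sumTo : ∀ n → + primeCount n ≡ sumTo n (isPrimeFactor n)
primeCount≡sumTo n = sumIfℕ≡sumTo (λ q → does (prime? q) ∧ does (q ∣? n)) (λ _ → 1) n

module _ {p e : ℕ} (p-prime : Prime p) .{{_ : ℕ.NonZero e}} where
  private instance
    p≢0 : ℕ.NonZero p
    p≢0 = prime⇒nonZero p-prime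
    pe≢0 : ℕ.NonZero (p ℕ.* e)
    pe≢0 = ℕP.m*n≢0 p e

  μ-p*e-divisible : p ∣ e → μ (p ℕ.* e) ≡ + 0
  μ-p*e-divisible p∣e = μ-squarefull (p ℕ.* e) (squarefull-intro p-prime (*-monoʳ-∣ p p∣e))

  module _ (p∤e : ¬ (p ∣ e)) where
    squarefull-p*e : squarefull (p ℕ.* e) ≡ squarefull e
    squarefull-p*e = T-ext squares⇒ (λ sq → squares⇐ (squarefull-elim sq))
      where
      squares⇒ : T (squarefull (p ℕ.* e)) → T (squarefull e)
      squares⇒ sq with squarefull-elim sq
      ... | q , q-prime , qq∣pe = squarefull-intro q-prime (coprime-divisor coprime qq∣pe)
        where
        q≢p : q ≢ p
        q≢p refl = p∤e (*-cancelˡ-∣ p qq∣pe)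
        coprime : Coprime (q ℕ.* q) p
        coprime = ∤prime⇒coprime p-prime λ p∣qq →
          q≢p (sym (prime∣prime⇒≡ p-prime q-prime (prime∣p*e⇒∣e p-prime q-prime (q≢p ∘ sym) p∣qq)))
      squares⇐ : (Σ ℕ λ q → Prime q × q ℕ.* q ∣ e) → T (squarefull (p ℕ.* e))
      squares⇐ (q , q-prime , qq∣e) = squarefull-intro q-prime (∣n⇒∣m*n p qq∣e)

    primeFactors-p*e : ∀ q → isPrimeFactor (p ℕ.* e) q ≡ isPrimeFactor e q ℤ.+ when (does (q ≟ p)) (+ 1)
    primeFactors-p*e q with prime? q
    ... | no ¬q-prime = sym (trans (ℤP.+-identityˡ _) (when-no (q ≟ p) (+ 1) λ { refl → ¬q-prime p-prime }))
    ... | yes q-prime with q ≟ p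
    ...   | yes refl = begin
      when (does (p ∣? (p ℕ.* e))) (+ 1)   ≡⟨ when-yes (p ∣? (p ℕ.* e)) (+ 1) (m∣m*n e) ⟩
      + 1                                 ≡⟨ cong₂ ℤ._+_ (when-no (p ∣? e) (+ 1) p∤e) (when-yes (p ≟ p) (+ 1) refl) ⟨
      when (does (p ∣? e)) (+ 1) ℤ.+ when (does (p ≟ p)) (+ 1) ∎
      where open ≡-Reasoning
    ...   | no q≢p = begin
      when (does (q ∣? (p ℕ.* e))) (+ 1)
        ≡⟨ cong (λ b → when b (+ 1)) (does-cong (q ∣? (p ℕ.* e)) (q ∣? e) (prime∣p*e⇒∣e q-prime p-prime q≢p) (∣n⇒∣m*n p)) ⟩
      when (does (q ∣? e)) (+ 1)           ≡⟨ ℤP.+-identityʳ _ ⟨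
      when (does (q ∣? e)) (+ 1) ℤ.+ + 0   ≡⟨ cong (ℤ._+_ (when (does (q ∣? e)) (+ 1))) (when-no (q ≟ p) (+ 1) q≢p) ⟨
      when (does (q ∣? e)) (+ 1) ℤ.+ when (does (q ≟ p)) (+ 1) ∎
      where open ≡-Reasoning

    primeCount-p*e : primeCount (p ℕ.* e) ≡ suc (primeCount e)
    primeCount-p*e = trans (ℤP.+-injective counted) (ℕP.+-comm (primeCount e) 1)
      where
      open ≡-Reasoning
      isP : ℕ → ℤ
      isP q = when (does (q ≟ p)) (+ 1)
      beyond-e : ∀ q → e < q → q ≤ p ℕ.* e → isPrimeFactor e q ≡ + 0
      beyond-e q e<q _ with does (prime? q)
      ... | true  = when-no (q ∣? e) (+ 1) (λ q∣e → ℕP.<⇒≱ e<q (∣⇒≤ q∣e))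
      ... | false = refl
      counted : + primeCount (p ℕ.* e) ≡ + primeCount e ℤ.+ + 1
      counted = begin
        + primeCount (p ℕ.* e)                    ≡⟨ primeCount≡sumTo (p ℕ.* e) ⟩
        sumTo (p ℕ.* e) (isPrimeFactor (p ℕ.* e)) ≡⟨ sumTo-cong (p ℕ.* e) (λ q _ _ → primeFactors-p*e q) ⟩
        sumTo (p ℕ.* e) (λ q → isPrimeFactor e q ℤ.+ isP q) ≡⟨ sumTo-+ (p ℕ.* e) (isPrimeFactor e) isP ⟩
        sumTo (p ℕ.* e) (isPrimeFactor e) ℤ.+ sumTo (p ℕ.* e) isP
          ≡⟨ cong₂ ℤ._+_ (sumTo-cutoff e (p ℕ.* e) _ beyond-e (ℕP.m≤n*m e p))
                         (sumTo-single (p ℕ.* e) isP p (ℕ.>-nonZero⁻¹ p) (ℕP.m≤m*n p e)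
                            (λ q q≢p → when-no (q ≟ p) (+ 1) q≢p)) ⟩
        sumTo e (isPrimeFactor e) ℤ.+ isP p       ≡⟨ cong₂ ℤ._+_ (sym (primeCount≡sumTo e)) (when-yes (p ≟ p) (+ 1) refl) ⟩
        + primeCount e ℤ.+ + 1                    ∎

    μ-p*e-coprime : μ (p ℕ.* e) ≡ ℤ.- μ e
    μ-p*e-coprime = begin
      μ (p ℕ.* e)                                          ≡⟨ μ-unfold (p ℕ.* e) ⟩
      μ-value (squarefull (p ℕ.* e)) (primeCount (p ℕ.* e)) ≡⟨ cong₂ μ-value squarefull-p*e primeCount-p*e ⟩
      μ-value (squarefull e) (suc (primeCount e))          ≡⟨ μ-value-suc (squarefull e) (primeCount e) ⟩
      ℤ.- μ-value (squarefull e) (primeCount e)            ≡⟨ cong ℤ.-_ (μ-unfold e) ⟨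
      ℤ.- μ e                                              ∎
      where open ≡-Reasoning

-- ∑_{d ∣ N} μ(d) for N = p·M, p prime, split by whether p ∣ d: the
-- divisors d = k·p (k ∣ M) and the divisors k ∣ M prime to p cancel in pairs.
module MobiusSplit {N p M : ℕ} (p-prime : Prime p) .{{_ : ℕ.NonZero N}} (N≡p*M : N ≡ p ℕ.* M) where
  private instance
    p≢0 : ℕ.NonZero p
    p≢0 = prime⇒nonZero p-prime
    M≢0 : ℕ.NonZero M
    M≢0 = nonZero-factorʳ p M N≡p*M

  D onMultiples offMultiples h : ℕ → ℤ
  D e = when (does (e ∣? N)) (μ e)
  onMultiples e = when (does (p ∣? e)) (D e)
  offMultiples e = when (not (does (p ∣? e))) (D e)
  h k = when (not (does (p ∣? k))) (when (does (k ∣? M)) (μ k))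

  split : ∀ e → D e ≡ onMultiples e ℤ.+ offMultiples e
  split e with does (p ∣? e)
  ... | true  = sym (ℤP.+-identityʳ _)
  ... | false = sym (ℤP.+-identityˡ _)

  -- a divisor of N prime to p divides M
  coprimeToP : sumTo N offMultiples ≡ sumTo M h
  coprimeToP = trans (sumTo-cong N (λ e _ _ → same e))
                     (sumTo-cutoff M N h beyond-M (subst (M ≤_) (sym N≡p*M) (ℕP.m≤n*m M p)))
    where
    same : ∀ e → offMultiples e ≡ h e
    same e with p ∣? e
    ... | yes _   = refl
    ... | no p∤e  = cong (λ b → when b (μ e)) (does-cong (e ∣? N) (e ∣? M)
        (λ e∣N → coprime-divisor (∤prime⇒coprime p-prime p∤e) (subst (e ∣_) N≡p*M e∣N))
        (λ e∣M → subst (e ∣_) (sym N≡p*M) (∣n⇒∣m*n p e∣M)))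
    beyond-M : ∀ k → M < k → k ≤ N → h k ≡ + 0
    beyond-M k M<k _ with does (p ∣? k)
    ... | true  = refl
    ... | false = when-no (k ∣? M) (μ k) (λ k∣M → ℕP.<⇒≱ M<k (∣⇒≤ k∣M))

  -- k·p ∣ N iff k ∣ M, and μ(k·p) is 0 when p ∣ k and -μ(k) otherwise
  atMultiple : ∀ k .{{_ : ℕ.NonZero k}} → onMultiples (k ℕ.* p) ≡ ℤ.- h k
  atMultiple k = begin
    onMultiples (k ℕ.* p)                      ≡⟨ when-yes (p ∣? (k ℕ.* p)) (D (k ℕ.* p)) (n∣m*n k) ⟩
    when (does ((k ℕ.* p) ∣? N)) (μ (k ℕ.* p)) ≡⟨ cong₂ when divides-N⇔M (cong μ (ℕP.*-comm k p)) ⟩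
    when (does (k ∣? M)) (μ (p ℕ.* k))         ≡⟨ byCases (p ∣? k) ⟩
    ℤ.- h k                                    ∎
    where
    open ≡-Reasoning
    divides-N⇔M : does ((k ℕ.* p) ∣? N) ≡ does (k ∣? M)
    divides-N⇔M = does-cong ((k ℕ.* p) ∣? N) (k ∣? M)
      (λ kp∣N → *-cancelʳ-∣ p (subst (k ℕ.* p ∣_) (trans N≡p*M (ℕP.*-comm p M)) kp∣N))
      (λ k∣M → subst (k ℕ.* p ∣_) (trans (ℕP.*-comm M p) (sym N≡p*M)) (*-monoˡ-∣ p k∣M))
    byCases : (p∣?k : Dec (p ∣ k)) →
      when (does (k ∣? M)) (μ (p ℕ.* k)) ≡ ℤ.- when (not (does p∣?k)) (when (does (k ∣? M)) (μ k))
    byCases (yes p∣k) = trans (cong (when (does (k ∣? M))) (μ-p*e-divisible p-prime p∣k)) (when-0 (does (k ∣? M)))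
    byCases (no p∤k)  = trans (cong (when (does (k ∣? M))) (μ-p*e-coprime p-prime p∤k)) (when-neg (does (k ∣? M)) (μ k))

  multiplesOfP : sumTo N onMultiples ≡ sumTo M (λ k → ℤ.- h k)
  multiplesOfP = begin
    sumTo N onMultiples                   ≡⟨ cong (λ t → sumTo t onMultiples) (trans N≡p*M (ℕP.*-comm p M)) ⟩
    sumTo (M ℕ.* p) onMultiples           ≡⟨ sumTo-multiples p M onMultiples (λ e p∤e → when-no (p ∣? e) (D e) p∤e) ⟩
    sumTo M (λ k → onMultiples (k ℕ.* p)) ≡⟨ sumTo-cong M (λ k 1≤k _ → atMultiple k {{ℕ.>-nonZero 1≤k}}) ⟩
    sumTo M (λ k → ℤ.- h k)               ∎
    where open ≡-Reasoning

mobius : ∀ N .{{_ : ℕ.NonZero N}} → sumTo N (λ d → when (does (d ∣? N)) (μ d)) ≡ when (does (N ≟ 1)) (+ 1)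
mobius (suc zero) = refl
mobius N@(suc (suc _)) with primeFactor N (s≤s (s≤s z≤n))
... | p , p-prime , M , N≡p*M = begin
  sumTo N D                                          ≡⟨ sumTo-cong N (λ e _ _ → split e) ⟩
  sumTo N (λ e → onMultiples e ℤ.+ offMultiples e)   ≡⟨ sumTo-+ N onMultiples offMultiples ⟩
  sumTo N onMultiples ℤ.+ sumTo N offMultiples       ≡⟨ cong₂ ℤ._+_ multiplesOfP coprimeToP ⟩
  sumTo M (λ k → ℤ.- h k) ℤ.+ sumTo M h              ≡⟨ sumTo-+ M (λ k → ℤ.- h k) h ⟨
  sumTo M (λ k → ℤ.- h k ℤ.+ h k)                    ≡⟨ sumTo-zero M _ (λ k _ _ → ℤP.+-inverseˡ (h k)) ⟩
  + 0                                                ∎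
  where
  open ≡-Reasoning
  open MobiusSplit p-prime N≡p*M

-- If c_ll = 1 and c_lj (j ≠ l) vanishes
-- unless h l < h j for a bounded height h, then C is injective on
-- vectors: by descending induction on h l, row l of C·u = C·v reads
-- u_l + (equal terms) = v_l + (equal terms).

unitriangular-injective : ∀ {m} (C : Fin m → Fin m → ℤ) (h : Fin m → ℕ) (H : ℕ) →
  (∀ l → h l ≤ H) → (∀ l → C l l ≡ + 1) → (∀ l j → j ≢ l → (C l j ≡ + 0) ⊎ (h l < h j)) →
  (u v : Fin m → ℤ) → (∀ l → (C ⊛ u) l ≡ (C ⊛ v) l) → ∀ l → u l ≡ v l
unitriangular-injective {suc m} C h H h≤H diag upper u v Cu≡Cv l = descend (suc (H ℕ.∸ h l)) l ℕP.≤-refl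
  where
  open ≡-Reasoning
  descend : ∀ fuel l → H ℕ.∸ h l < fuel → u l ≡ v l
  descend (suc fuel) l H-hl<fuel = begin
    u l                   ≡⟨ ℤP.*-identityˡ (u l) ⟨
    + 1 ℤ.* u l           ≡⟨ cong (ℤ._* u l) (diag l) ⟨
    C l l ℤ.* u l         ≡⟨ ∙-cancelʳ (rest u) _ _ (begin
        C l l ℤ.* u l ℤ.+ rest u ≡⟨ ℤSum.sum-remove (λ j → C l j ℤ.* u j) ⟨
        (C ⊛ u) l                 ≡⟨ Cu≡Cv l ⟩
        (C ⊛ v) l                 ≡⟨ ℤSum.sum-remove (λ j → C l j ℤ.* v j) ⟩
        C l l ℤ.* v l ℤ.+ rest v  ≡⟨ cong (ℤ._+_ (C l l ℤ.* v l)) (sym rest-equal) ⟩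
        C l l ℤ.* v l ℤ.+ rest u  ∎) ⟩
    C l l ℤ.* v l         ≡⟨ cong (ℤ._* v l) (diag l) ⟩
    + 1 ℤ.* v l           ≡⟨ ℤP.*-identityˡ (v l) ⟩
    v l                   ∎
    where
    rest : (Fin (suc m) → ℤ) → ℤ
    rest w = sum (λ k → C l (punchIn l k) ℤ.* w (punchIn l k))
    offDiagonal : ∀ j → j ≢ l → C l j ℤ.* u j ≡ C l j ℤ.* v j
    offDiagonal j j≢l with upper l j j≢l
    ... | inj₁ c≡0    = trans (cong (ℤ._* u j) c≡0) (sym (cong (ℤ._* v j) c≡0))
    ... | inj₂ hl<hj = cong (C l j ℤ.*_)
      (descend fuel j (ℕP.<-≤-trans (ℕP.∸-monoʳ-< hl<hj (h≤H j)) (ℕP.≤-pred H-hl<fuel)))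
    rest-equal : rest u ≡ rest v
    rest-equal = sum-cong-≗ (λ k → offDiagonal (punchIn l k) (punchInᵢ≢i l k))

module RationalArithmetic where
  open import Data.Rational.Unnormalised as ℚᵘ using (ℚᵘ; mkℚᵘ; *≡*) renaming (_≃_ to _≃ᵘ_)
  import Data.Rational.Unnormalised.Properties as ℚᵘP
  module ≃-Reasoning = Relation.Binary.Reasoning.Setoid ℚᵘP.≃-setoid

  toℚᵘ-ℤtoℚ : ∀ z → ℚ.toℚᵘ (ℤtoℚ z) ≃ᵘ mkℚᵘ z 0
  toℚᵘ-ℤtoℚ z = ℚP.toℚᵘ-fromℚᵘ (mkℚᵘ z 0)

  ℤtoℚ-+ : ∀ a b → ℤtoℚ (a ℤ.+ b) ≡ ℤtoℚ a ℚ.+ ℤtoℚ b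
  ℤtoℚ-+ a b = ℚP.toℚᵘ-injective (begin
    ℚ.toℚᵘ (ℤtoℚ (a ℤ.+ b))                  ≈⟨ toℚᵘ-ℤtoℚ (a ℤ.+ b) ⟩
    mkℚᵘ (a ℤ.+ b) 0
      ≈⟨ *≡* (cong (ℤ._* + 1) (sym (cong₂ ℤ._+_ (ℤP.*-identityʳ a) (ℤP.*-identityʳ b)))) ⟩
    mkℚᵘ a 0 ℚᵘ.+ mkℚᵘ b 0                   ≈⟨ ℚᵘP.+-cong (toℚᵘ-ℤtoℚ a) (toℚᵘ-ℤtoℚ b) ⟨
    ℚ.toℚᵘ (ℤtoℚ a) ℚᵘ.+ ℚ.toℚᵘ (ℤtoℚ b)     ≈⟨ ℚP.toℚᵘ-homo-+ (ℤtoℚ a) (ℤtoℚ b) ⟨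
    ℚ.toℚᵘ (ℤtoℚ a ℚ.+ ℤtoℚ b)               ∎)
    where open ≃-Reasoning

  ℤtoℚ-* : ∀ a b → ℤtoℚ (a ℤ.* b) ≡ ℤtoℚ a * ℤtoℚ b
  ℤtoℚ-* a b = ℚP.toℚᵘ-injective (begin
    ℚ.toℚᵘ (ℤtoℚ (a ℤ.* b))                  ≈⟨ toℚᵘ-ℤtoℚ (a ℤ.* b) ⟩
    mkℚᵘ a 0 ℚᵘ.* mkℚᵘ b 0                   ≈⟨ ℚᵘP.*-cong (toℚᵘ-ℤtoℚ a) (toℚᵘ-ℤtoℚ b) ⟨
    ℚ.toℚᵘ (ℤtoℚ a) ℚᵘ.* ℚ.toℚᵘ (ℤtoℚ b)     ≈⟨ ℚP.toℚᵘ-homo-* (ℤtoℚ a) (ℤtoℚ b) ⟨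
    ℚ.toℚᵘ (ℤtoℚ a * ℤtoℚ b)                 ∎)
    where open ≃-Reasoning

  ℤtoℚ-sum : ∀ {m} (f : Fin m → ℤ) → ℤtoℚ (sum f) ≡ ℚSum.sum (λ i → ℤtoℚ (f i))
  ℤtoℚ-sum {zero}  f = refl
  ℤtoℚ-sum {suc m} f = trans (ℤtoℚ-+ (f zero) _) (cong (ℤtoℚ (f zero) ℚ.+_) (ℤtoℚ-sum (λ i → f (suc i))))

  inverse : ∀ k → ℤtoℚ (+ suc k) * ((+ 1) ℚ./ suc k) ≡ ℚ.1ℚ
  inverse k = ℚP.toℚᵘ-injective (begin
    ℚ.toℚᵘ (ℤtoℚ (+ suc k) * ((+ 1) ℚ./ suc k))      ≈⟨ ℚP.toℚᵘ-homo-* (ℤtoℚ (+ suc k)) ((+ 1) ℚ./ suc k) ⟩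
    ℚ.toℚᵘ (ℤtoℚ (+ suc k)) ℚᵘ.* ℚ.toℚᵘ ((+ 1) ℚ./ suc k)
      ≈⟨ ℚᵘP.*-cong (toℚᵘ-ℤtoℚ (+ suc k)) (ℚP.toℚᵘ-fromℚᵘ (mkℚᵘ (+ 1) k)) ⟩
    mkℚᵘ (+ suc k) 0 ℚᵘ.* mkℚᵘ (+ 1) k               ≈⟨ *≡* cross ⟩
    ℚ.toℚᵘ ℚ.1ℚ                                      ∎)
    where
    open ≃-Reasoning
    cross : (+ suc k ℤ.* + 1) ℤ.* + 1 ≡ + 1 ℤ.* + (1 ℕ.* suc k)
    cross = trans (ℤP.*-identityʳ _) (trans (ℤP.*-identityʳ _)
              (sym (trans (ℤP.*-identityˡ _) (cong +_ (ℕP.*-identityˡ (suc k))))))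

  ÷ℕ-cancel : ∀ a .{{_ : ℕ.NonZero a}} t → (ℤtoℚ (+ a) * t) ÷ℕ a ≡ t
  ÷ℕ-cancel (suc k) t = begin
    (A * t) * r   ≡⟨ cong (_* r) (ℚP.*-comm A t) ⟩
    (t * A) * r   ≡⟨ ℚP.*-assoc t A r ⟩
    t * (A * r)   ≡⟨ cong (t *_) (inverse k) ⟩
    t * ℚ.1ℚ      ≡⟨ ℚP.*-identityʳ t ⟩
    t             ∎
    where
    open ≡-Reasoning
    A = ℤtoℚ (+ suc k)
    r = (+ 1) ℚ./ suc k

  ÷ℕ-sum : ∀ {m} a .{{_ : ℕ.NonZero a}} (f : Fin m → ℚ) → ℚSum.sum f ÷ℕ a ≡ ℚSum.sum (λ i → f i ÷ℕ a)
  ÷ℕ-sum (suc k) f = ℚSum.*-distribʳ-sum ((+ 1) ℚ./ suc k) f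

  *-÷ℕ : ∀ a .{{_ : ℕ.NonZero a}} p q → p * (q ÷ℕ a) ≡ (p * q) ÷ℕ a
  *-÷ℕ (suc k) p q = sym (ℚP.*-assoc p q ((+ 1) ℚ./ suc k))

open RationalArithmetic

ℕsum : ∀ {n} → (Fin n → ℕ) → ℕ
ℕsum = SemiringSums.sum ℕP.+-*-semiring

term≤ℕsum : ∀ {n} (y : Fin n → ℕ) i → y i ≤ ℕsum y
term≤ℕsum y zero    = ℕP.m≤m+n _ _
term≤ℕsum y (suc i) = ℕP.≤-trans (term≤ℕsum (λ i → y (suc i)) i) (ℕP.m≤n+m _ (y zero))

module GcdClosedSet {m : ℕ} (x : Fin m → ℕ) (pos : ∀ i → 0 < x i)
                    (inj : Injective _≡_ _≡_ x) (closed : GcdClosed x) where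

  private instance
    x≢0 : ∀ {i} → ℕ.NonZero (x i)
    x≢0 {i} = ℕ.>-nonZero (pos i)

  -- x_l is the least element of S that is a multiple of y: the condition
  -- in the definitions of c (with y = d·x_i) and α (with y = d)
  leastMultiple? : Fin m → ℕ → Bool
  leastMultiple? l y = does (y ∣? x l) ∧ allF (λ k → not (does (x k <? x l)) ∨ not (does (y ∣? x k)))

  record LeastMultiple (l : Fin m) (y : ℕ) : Set where
    constructor mkLeast
    field holds : T (leastMultiple? l y)

  least? : ∀ l y → Dec (LeastMultiple l y)
  least? l y with T? (leastMultiple? l y)
  ... | yes holds = yes (mkLeast holds)
  ... | no ¬holds = no (λ least → ¬holds (LeastMultiple.holds least))

  when-least : ∀ {l y} v → LeastMultiple l y → when (leastMultiple? l y) v ≡ v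
  when-least v (mkLeast holds) = when-T holds

  when-notLeast : ∀ {l y} v → ¬ LeastMultiple l y → when (leastMultiple? l y) v ≡ + 0
  when-notLeast {l} {y} v ¬least = cong (λ b → when b v) (¬T⇒≡false (λ holds → ¬least (mkLeast holds)))

  least-∣ : ∀ {l y} → LeastMultiple l y → y ∣ x l
  least-∣ {l} {y} (mkLeast holds) = from-does (y ∣? x l) (proj₁ (Equivalence.to T-∧ holds))

  least-minimal : ∀ {l y k} → LeastMultiple l y → x k < x l → ¬ (y ∣ x k)
  least-minimal {l} {y} {k} (mkLeast holds) = implies-not-elim (x k <? x l) (y ∣? x k)
    (allF-elim _ (proj₂ (Equivalence.to T-∧ holds)) k)

  least-intro : ∀ {l y} → y ∣ x l → (∀ k → x k < x l → ¬ (y ∣ x k)) → LeastMultiple l y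
  least-intro {l} {y} y∣xl minimal = mkLeast (Equivalence.from T-∧
    (to-does (y ∣? x l) y∣xl , allF-intro _ (λ k → implies-not-intro (x k <? x l) (y ∣? x k) (minimal k))))

  -- every x_j divisible by y is a multiple of the least one: gcd(x_l, x_j)
  -- lies in S, is divisible by y and is at most x_l, hence equals x_l
  least-∣-multiples : ∀ {l y j} → LeastMultiple l y → y ∣ x j → x l ∣ x j
  least-∣-multiples {l} {y} {j} least y∣xj with closed l j
  ... | t , xt≡gcd with ℕP.m≤n⇒m<n∨m≡n xt≤xl
    where
    xt≤xl : x t ≤ x l
    xt≤xl = ∣⇒≤ (subst (_∣ x l) (sym xt≡gcd) (gcd[m,n]∣m (x l) (x j)))
  ... | inj₁ xt<xl = ⊥-elim (least-minimal least xt<xl (subst (y ∣_) (sym xt≡gcd) (gcd-greatest (least-∣ least) y∣xj)))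
  ... | inj₂ xt≡xl = subst (_∣ x j) (trans (sym xt≡gcd) xt≡xl) (gcd[m,n]∣n (x l) (x j))

  least-unique : ∀ {l l′ y} → LeastMultiple l y → LeastMultiple l′ y → l ≡ l′
  least-unique least least′ =
    inj (∣-antisym (least-∣-multiples least (least-∣ least′)) (least-∣-multiples least′ (least-∣ least)))

  least-exists : ∀ {y j} → y ∣ x j → Σ (Fin m) λ l → LeastMultiple l y
  least-exists {y} {j} y∣xj = descend (x j) j ℕP.≤-refl y∣xj
    where
    descend : ∀ v j → x j ≤ v → y ∣ x j → Σ (Fin m) λ l → LeastMultiple l y
    descend zero    j xj≤0  _    = ⊥-elim (ℕP.<⇒≱ (pos j) xj≤0)
    descend (suc v) j xj≤1+v y∣xj with T? (allF (λ k → not (does (x k <? x j)) ∨ not (does (y ∣? x k))))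
    ... | yes minimal = j , mkLeast (Equivalence.from T-∧ (to-does (y ∣? x j) y∣xj , minimal))
    ... | no ¬minimal with allF-counterexample _ ¬minimal
    ...   | k , fails with implies-not-fails (x k <? x j) (y ∣? x k) fails
    ...     | xk<xj , y∣xk = descend v k (ℕP.≤-pred (ℕP.≤-trans xk<xj xj≤1+v)) y∣xk

  least-self : ∀ n → LeastMultiple n (x n)
  least-self n = least-intro ∣-refl (λ k xk<xn xn∣xk → ℕP.<⇒≱ xk<xn (∣⇒≤ xn∣xk))

  least-≥ : ∀ {l y} → LeastMultiple l y → y ≤ x l
  least-≥ least = ∣⇒≤ (least-∣ least)

  B : ℕ
  B = ℕsum x

  x≤B : ∀ i → x i ≤ B
  x≤B = term≤ℕsum x

  c≡sumTo : ∀ k l → c x k l ≡ sumTo B (λ d → when (leastMultiple? l (d ℕ.* x k)) (μ d))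
  c≡sumTo k l = trans (sumIfℤ≡sumTo (λ d → leastMultiple? l (d ℕ.* x k)) μ (x l))
                      (sym (sumTo-cutoff (x l) B _ beyond (x≤B l)))
    where
    beyond : ∀ d → x l < d → d ≤ B → when (leastMultiple? l (d ℕ.* x k)) (μ d) ≡ + 0
    beyond d xl<d _ = when-notLeast (μ d) (λ least → ℕP.<⇒≱ xl<d (ℕP.≤-trans (ℕP.m≤m*n d (x k)) (least-≥ least)))

  α≡sumTo : ∀ l → + α x l ≡ sumTo B (λ d → when (leastMultiple? l d) (+ φ d))
  α≡sumTo l = trans (sumIfℕ≡sumTo (leastMultiple? l) φ (x l)) (sym (sumTo-cutoff (x l) B _ beyond (x≤B l)))
    where
    beyond : ∀ d → x l < d → d ≤ B → when (leastMultiple? l d) (+ φ d) ≡ + 0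
    beyond d xl<d _ = when-notLeast (+ φ d) (λ least → ℕP.<⇒≱ xl<d (least-≥ least))

  sum-least : ∀ y j (F : Fin m → ℤ) v → (∀ l → LeastMultiple l y → F l ≡ v) → (¬ (y ∣ x j) → v ≡ + 0) →
              sum (λ l → when (leastMultiple? l y) (F l)) ≡ v
  sum-least y j F v atLeast vanish with y ∣? x j
  ... | yes y∣xj with least-exists y∣xj
  ...   | l₀ , least₀ = trans (ℤsum-single _ l₀ others) (trans (when-least (F l₀) least₀) (atLeast l₀ least₀))
    where
    others : ∀ l → l ≢ l₀ → when (leastMultiple? l y) (F l) ≡ + 0
    others l l≢l₀ = when-notLeast (F l) (λ least → l≢l₀ (least-unique least least₀))
  sum-least y j F v atLeast vanish | no y∤xj = trans (ℤsum-zero _ zero-term) (sym (vanish y∤xj))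
    where
    zero-term : ∀ l → when (leastMultiple? l y) (F l) ≡ + 0
    zero-term l with least? l y
    ... | yes least = trans (when-least (F l) least) (trans (atLeast l least) (vanish y∤xj))
    ... | no ¬least = when-notLeast (F l) ¬least

  ζ : Fin m → Fin m → ℤ
  ζ l j = when (does (x l ∣? x j)) (+ 1)

  C : Fin m → Fin m → ℤ
  C = c x

  ζᵀα : Fin m → Fin m → ℤ
  ζᵀα j l = ζ l j ℤ.* + α x l

  ζ-least : ∀ {l y} j → LeastMultiple l y → ζ l j ≡ when (does (y ∣? x j)) (+ 1)
  ζ-least {l} {y} j least = cong (λ b → when b (+ 1))
    (does-cong (x l ∣? x j) (y ∣? x j) (∣-trans (least-∣ least)) (least-∣-multiples least))

  divides-gcd : ∀ j s d w →
    when (does (d ∣? gcd (x j) (x s))) w ≡ when (does (d ∣? x s)) (when (does (d ∣? x j)) (+ 1)) ℤ.* w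
  divides-gcd j s d w with d ∣? x j | d ∣? x s
  ... | yes d∣xj | yes d∣xs = trans (when-yes (d ∣? gcd (x j) (x s)) w (gcd-greatest d∣xj d∣xs)) (sym (ℤP.*-identityˡ w))
  ... | yes _    | no d∤xs  =
    trans (when-no (d ∣? gcd (x j) (x s)) w (λ d∣g → d∤xs (∣-trans d∣g (gcd[m,n]∣n (x j) (x s))))) (sym (ℤP.*-zeroˡ w))
  ... | no d∤xj  | yes _    =
    trans (when-no (d ∣? gcd (x j) (x s)) w (λ d∣g → d∤xj (∣-trans d∣g (gcd[m,n]∣m (x j) (x s))))) (sym (ℤP.*-zeroˡ w))
  ... | no d∤xj  | no _     =
    trans (when-no (d ∣? gcd (x j) (x s)) w (λ d∣g → d∤xj (∣-trans d∣g (gcd[m,n]∣m (x j) (x s))))) (sym (ℤP.*-zeroˡ w))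

  -- By Gauss, gcd(x_j, x_s) = ∑ φ(d) over the common divisors d, and the
  -- common divisors with least multiple x_l contribute α_l when x_l ∣ x_j, x_s.
  gcd-structure : ∀ j s → + gcd (x j) (x s) ≡ (ζᵀα ⊗ ζ) j s
  gcd-structure j s = begin
    + g                                                              ≡⟨ gauss g ⟨
    sumTo g (λ d → when (does (d ∣? g)) (+ φ d))                     ≡⟨ sumTo-cutoff g B _ beyond g≤B ⟨
    sumTo B (λ d → when (does (d ∣? g)) (+ φ d))                     ≡⟨ sumTo-cong B (λ d _ _ → grouped d) ⟩
    sumTo B (λ d → sum (λ l → when (leastMultiple? l d) (ζζ l)) ℤ.* + φ d)
      ≡⟨ sumTo-cong B (λ d _ _ → *-distribʳ-sum (+ φ d) (λ l → when (leastMultiple? l d) (ζζ l))) ⟩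
    sumTo B (λ d → sum (λ l → when (leastMultiple? l d) (ζζ l) ℤ.* + φ d))
      ≡⟨ sumTo-sum B (λ d l → when (leastMultiple? l d) (ζζ l) ℤ.* + φ d) ⟩
    sum (λ l → sumTo B (λ d → when (leastMultiple? l d) (ζζ l) ℤ.* + φ d))
      ≡⟨ sum-cong-≗ (λ l → sumTo-cong B (λ d _ _ → when-*ˡ (leastMultiple? l d) (ζζ l) (+ φ d))) ⟩
    sum (λ l → sumTo B (λ d → ζζ l ℤ.* when (leastMultiple? l d) (+ φ d)))
      ≡⟨ sum-cong-≗ (λ l → trans (sym (sumTo-*ˡ B (ζζ l) _)) (cong (ℤ._*_ (ζζ l)) (sym (α≡sumTo l)))) ⟩
    sum (λ l → ζζ l ℤ.* + α x l)
      ≡⟨ sum-cong-≗ (λ l → rearrange (ζ l j) (ζ l s) (+ α x l)) ⟩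
    (ζᵀα ⊗ ζ) j s                                                    ∎
    where
    open ≡-Reasoning
    g = gcd (x j) (x s)
    instance
      g≢0 : ℕ.NonZero g
      g≢0 = ℕ.≢-nonZero (λ g≡0 → ℕ.≢-nonZero⁻¹ (x j) (gcd[m,n]≡0⇒m≡0 g≡0))
    g≤B : g ≤ B
    g≤B = ℕP.≤-trans (∣⇒≤ (gcd[m,n]∣m (x j) (x s))) (x≤B j)
    beyond : ∀ d → g < d → d ≤ B → when (does (d ∣? g)) (+ φ d) ≡ + 0
    beyond d g<d _ = when-no (d ∣? g) (+ φ d) (λ d∣g → ℕP.<⇒≱ g<d (∣⇒≤ d∣g))
    ζζ : Fin m → ℤ
    ζζ l = ζ l j ℤ.* ζ l s
    grouped : ∀ d → when (does (d ∣? g)) (+ φ d) ≡ sum (λ l → when (leastMultiple? l d) (ζζ l)) ℤ.* + φ d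
    grouped d = trans (divides-gcd j s d (+ φ d)) (cong (ℤ._* + φ d) (sym (sum-least d j ζζ _ atLeast vanish)))
      where
      atLeast : ∀ l → LeastMultiple l d → ζζ l ≡ when (does (d ∣? x s)) (when (does (d ∣? x j)) (+ 1))
      atLeast l least = trans (cong₂ ℤ._*_ (ζ-least j least) (ζ-least s least)) (when-1 (does (d ∣? x s)) _)
      vanish : ¬ (d ∣ x j) → when (does (d ∣? x s)) (when (does (d ∣? x j)) (+ 1)) ≡ + 0
      vanish d∤xj = trans (cong (when (does (d ∣? x s))) (when-no (d ∣? x j) (+ 1) d∤xj)) (when-0 _)
    rearrange : ∀ a b w → (a ℤ.* b) ℤ.* w ≡ (a ℤ.* w) ℤ.* b
    rearrange a b w = trans (ℤP.*-assoc a b w) (trans (cong (ℤ._*_ a) (ℤP.*-comm b w)) (sym (ℤP.*-assoc a w b)))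

  -- ∑_{d ≤ B, d·x_k ∣ x_j} μ(d) = [k = j]: if x_j = N·x_k, this is ∑_{d ∣ N} μ(d)
  mobius-on-S : ∀ k j → sumTo B (λ d → when (does ((d ℕ.* x k) ∣? x j)) (μ d)) ≡ 𝟙 k j
  mobius-on-S k j with x k ∣? x j
  ... | no xk∤xj = trans (sumTo-zero B _ (λ d _ _ → when-no ((d ℕ.* x k) ∣? x j) (μ d) (xk∤xj ∘ m*n∣⇒n∣ d (x k))))
                         (sym (when-no (k ≟F j) (+ 1) (λ { refl → xk∤xj ∣-refl })))
  ... | yes (divides N xj≡N*xk) = begin
    sumTo B (λ d → when (does ((d ℕ.* x k) ∣? x j)) (μ d)) ≡⟨ sumTo-cong B (λ d _ _ → cong (λ b → when b (μ d)) (cancel d)) ⟩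
    sumTo B (λ d → when (does (d ∣? N)) (μ d))             ≡⟨ sumTo-cutoff N B _ beyond N≤B ⟩
    sumTo N (λ d → when (does (d ∣? N)) (μ d))             ≡⟨ mobius N ⟩
    when (does (N ≟ 1)) (+ 1)
      ≡⟨ cong (λ b → when b (+ 1)) (does-cong (N ≟ 1) (k ≟F j) N≡1⇒k≡j k≡j⇒N≡1) ⟩
    𝟙 k j                                                  ∎
    where
    open ≡-Reasoning
    instance
      N≢0 : ℕ.NonZero N
      N≢0 = nonZero-factorˡ N (x k) xj≡N*xk
    N≤B : N ≤ B
    N≤B = ℕP.≤-trans (subst (N ≤_) (sym xj≡N*xk) (ℕP.m≤m*n N (x k))) (x≤B j)
    cancel : ∀ d → does ((d ℕ.* x k) ∣? x j) ≡ does (d ∣? N)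
    cancel d = does-cong ((d ℕ.* x k) ∣? x j) (d ∣? N)
      (λ dxk∣xj → *-cancelʳ-∣ (x k) (subst (d ℕ.* x k ∣_) xj≡N*xk dxk∣xj))
      (λ d∣N → subst (d ℕ.* x k ∣_) (sym xj≡N*xk) (*-monoˡ-∣ (x k) d∣N))
    beyond : ∀ d → N < d → d ≤ B → when (does (d ∣? N)) (μ d) ≡ + 0
    beyond d N<d _ = when-no (d ∣? N) (μ d) (λ d∣N → ℕP.<⇒≱ N<d (∣⇒≤ d∣N))
    N≡1⇒k≡j : N ≡ 1 → k ≡ j
    N≡1⇒k≡j refl = inj (trans (sym (ℕP.*-identityˡ (x k))) (sym xj≡N*xk))
    k≡j⇒N≡1 : k ≡ j → N ≡ 1
    k≡j⇒N≡1 refl = ℕP.*-cancelʳ-≡ N 1 (x k) (trans (sym xj≡N*xk) (sym (ℕP.*-identityˡ (x k))))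

  -- C is a left inverse of ζ: ∑_l c_kl [x_l ∣ x_j] = ∑_{d : d·x_k ∣ x_j} μ(d) = [k = j],
  -- since d·x_k ∣ x_j iff the least multiple x_l of d·x_k divides x_j
  C⊗ζ≡𝟙 : ∀ k j → (C ⊗ ζ) k j ≡ 𝟙 k j
  C⊗ζ≡𝟙 k j = begin
    sum (λ l → C k l ℤ.* ζ l j)
      ≡⟨ sum-cong-≗ (λ l → trans (cong (ℤ._* ζ l j) (c≡sumTo k l)) (trans (ℤP.*-comm _ (ζ l j)) (sumTo-*ˡ B (ζ l j) _))) ⟩
    sum (λ l → sumTo B (λ d → ζ l j ℤ.* term l d))          ≡⟨ sumTo-sum B (λ d l → ζ l j ℤ.* term l d) ⟨
    sumTo B (λ d → sum (λ l → ζ l j ℤ.* term l d))          ≡⟨ sumTo-cong B (λ d _ _ → pull-μ d) ⟩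
    sumTo B (λ d → μ d ℤ.* sum (λ l → when (leastMultiple? l (d ℕ.* x k)) (ζ l j)))
      ≡⟨ sumTo-cong B (λ d _ _ → cong (ℤ._*_ (μ d)) (least-divides d)) ⟩
    sumTo B (λ d → μ d ℤ.* when (does ((d ℕ.* x k) ∣? x j)) (+ 1)) ≡⟨ sumTo-cong B (λ d _ _ → when-1 _ (μ d)) ⟩
    sumTo B (λ d → when (does ((d ℕ.* x k) ∣? x j)) (μ d))  ≡⟨ mobius-on-S k j ⟩
    𝟙 k j                                                   ∎
    where
    open ≡-Reasoning
    term : Fin m → ℕ → ℤ
    term l d = when (leastMultiple? l (d ℕ.* x k)) (μ d)
    least-divides : ∀ d → sum (λ l → when (leastMultiple? l (d ℕ.* x k)) (ζ l j)) ≡ when (does ((d ℕ.* x k) ∣? x j)) (+ 1)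
    least-divides d = sum-least (d ℕ.* x k) j (λ l → ζ l j) _ (λ l → ζ-least j) (when-no ((d ℕ.* x k) ∣? x j) (+ 1))
    pull-μ : ∀ d → sum (λ l → ζ l j ℤ.* term l d) ≡ μ d ℤ.* sum (λ l → when (leastMultiple? l (d ℕ.* x k)) (ζ l j))
    pull-μ d = trans (sum-cong-≗ (λ l → trans (ℤP.*-comm (ζ l j) _) (when-*ˡ (leastMultiple? l (d ℕ.* x k)) (μ d) (ζ l j))))
                     (sym (*-distribˡ-sum {m} (μ d) _))

  c-offDivisor : ∀ k n → ¬ (x k ∣ x n) → C k n ≡ + 0
  c-offDivisor k n xk∤xn = trans (c≡sumTo k n) (sumTo-zero B _ (λ d _ _ → when-notLeast (μ d)
    (λ least → xk∤xn (m*n∣⇒n∣ d (x k) (least-∣ least)))))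

  c-diagonal : ∀ n → C n n ≡ + 1
  c-diagonal n = begin
    C n n                         ≡⟨ ℤP.*-identityʳ (C n n) ⟨
    C n n ℤ.* + 1                 ≡⟨ cong (ℤ._*_ (C n n)) (when-yes (x n ∣? x n) (+ 1) ∣-refl) ⟨
    C n n ℤ.* ζ n n               ≡⟨ ℤsum-single _ n others ⟨
    (C ⊗ ζ) n n                   ≡⟨ C⊗ζ≡𝟙 n n ⟩
    𝟙 n n                         ≡⟨ ℤMat.𝟙-diag n ⟩
    + 1                           ∎
    where
    open ≡-Reasoning
    -- c_nl ζ_ln ≠ 0 needs x_n ∣ x_l and x_l ∣ x_n, i.e. l = n
    others : ∀ l → l ≢ n → C n l ℤ.* ζ l n ≡ + 0
    others l l≢n with x l ∣? x n | x n ∣? x l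
    ... | no _      | _         = ℤP.*-zeroʳ (C n l)
    ... | yes xl∣xn | yes xn∣xl = ⊥-elim (l≢n (inj (∣-antisym xl∣xn xn∣xl)))
    ... | yes _     | no xn∤xl  = cong (ℤ._* + 1) (c-offDivisor n l xn∤xl)

  c-upper : ∀ l j → j ≢ l → (C l j ≡ + 0) ⊎ (x l < x j)
  c-upper l j j≢l with x l ∣? x j
  ... | no xl∤xj = inj₁ (c-offDivisor l j xl∤xj)
  ... | yes xl∣xj with ℕP.m≤n⇒m<n∨m≡n (∣⇒≤ xl∣xj)
  ...   | inj₁ xl<xj = inj₂ xl<xj
  ...   | inj₂ xl≡xj = ⊥-elim (j≢l (inj (sym xl≡xj)))

  -- C is also a right inverse of ζ: both C·(ζ·C) and C·𝟙 equal C, and C is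
  -- injective, being unitriangular
  ζ⊛C≡𝟙 : ∀ n l → (ζ ⊛ (λ k → C k n)) l ≡ 𝟙 l n
  ζ⊛C≡𝟙 n = unitriangular-injective C x B x≤B c-diagonal c-upper _ _ sameImage
    where
    sameImage : ∀ l → (C ⊛ (ζ ⊛ (λ k → C k n))) l ≡ (C ⊛ (λ k → 𝟙 k n)) l
    sameImage l = begin
      (C ⊛ (ζ ⊛ (λ k → C k n))) l ≡⟨ ⊛-assoc C ζ _ l ⟩
      ((C ⊗ ζ) ⊛ (λ k → C k n)) l ≡⟨ ⊛-cong C⊗ζ≡𝟙 (λ k → refl) l ⟩
      (𝟙 ⊛ (λ k → C k n)) l        ≡⟨ 𝟙-⊛ _ l ⟩
      C l n                        ≡⟨ ⊛-column C n l ⟨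
      (C ⊛ (λ k → 𝟙 k n)) l        ∎
      where open ≡-Reasoning

  gcd⊛C : ∀ n j → sum (λ s → + gcd (x j) (x s) ℤ.* C s n) ≡ ζ n j ℤ.* + α x n
  gcd⊛C n j = begin
    sum (λ s → + gcd (x j) (x s) ℤ.* C s n) ≡⟨ ⊛-cong gcd-structure (λ s → refl) j ⟩
    ((ζᵀα ⊗ ζ) ⊛ (λ s → C s n)) j            ≡⟨ ⊛-assoc ζᵀα ζ _ j ⟨
    (ζᵀα ⊛ (ζ ⊛ (λ s → C s n))) j            ≡⟨ ⊛-cong {A = ζᵀα} (λ _ _ → refl) (ζ⊛C≡𝟙 n) j ⟩
    (ζᵀα ⊛ (λ l → 𝟙 l n)) j                  ≡⟨ ⊛-column ζᵀα n j ⟩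
    ζ n j ℤ.* + α x n                       ∎
    where open ≡-Reasoning

  -- α_n ≥ φ(x_n) ≥ 1, as d = x_n is counted in α_n
  α-pos : ∀ n → ℕ.NonZero (α x n)
  α-pos n = ℕ.>-nonZero (ℕP.≤-trans (φ-pos (x n))
    (term≤sumIfℕ (leastMultiple? n) φ (∈-oneTo (pos n) ℕP.≤-refl) (LeastMultiple.holds (least-self n))))

  solution : Fin m → Fin m → ℚ
  solution n s = ℤtoℚ (C s n) ÷ℕ α x n

  gcdMat⊛solution : ∀ n j → (gcdMat x ℚMat.⊛ solution n) j ≡ ℤtoℚ (ζ n j)
  gcdMat⊛solution n j = begin
    ℚSum.sum (λ s → ℤtoℚ (+ gcd (x j) (x s)) * (ℤtoℚ (C s n) ÷ℕ a))
      ≡⟨ ℚSum.sum-cong-≗ (λ s → *-÷ℕ a (ℤtoℚ (+ gcd (x j) (x s))) (ℤtoℚ (C s n))) ⟩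
    ℚSum.sum (λ s → (ℤtoℚ (+ gcd (x j) (x s)) * ℤtoℚ (C s n)) ÷ℕ a)
      ≡⟨ ÷ℕ-sum a (λ s → ℤtoℚ (+ gcd (x j) (x s)) * ℤtoℚ (C s n)) ⟨
    ℚSum.sum (λ s → ℤtoℚ (+ gcd (x j) (x s)) * ℤtoℚ (C s n)) ÷ℕ a
      ≡⟨ cong (_÷ℕ a) (trans (ℚSum.sum-cong-≗ (λ s → sym (ℤtoℚ-* (+ gcd (x j) (x s)) (C s n)))) (sym (ℤtoℚ-sum {m} _))) ⟩
    ℤtoℚ (sum (λ s → + gcd (x j) (x s) ℤ.* C s n)) ÷ℕ a ≡⟨ cong (λ t → ℤtoℚ t ÷ℕ a) (gcd⊛C n j) ⟩
    ℤtoℚ (ζ n j ℤ.* + a) ÷ℕ a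
      ≡⟨ cong (_÷ℕ a) (trans (cong ℤtoℚ (ℤP.*-comm (ζ n j) (+ a))) (ℤtoℚ-* (+ a) (ζ n j))) ⟩
    (ℤtoℚ (+ a) * ℤtoℚ (ζ n j)) ÷ℕ a                    ≡⟨ ÷ℕ-cancel a (ℤtoℚ (ζ n j)) ⟩
    ℤtoℚ (ζ n j)                                        ∎
    where
    open ≡-Reasoning
    a = α x n
    instance
      a≢0 : ℕ.NonZero a
      a≢0 = α-pos n

ΣF≡sum : ∀ {m} (f : Fin m → ℚ) → ΣF f ≡ ℚSum.sum f
ΣF≡sum {zero}  f = refl
ΣF≡sum {suc m} f = cong (f zero ℚ.+_) (ΣF≡sum (λ i → f (suc i)))

·≡⊗ : ∀ {m} (A B : Mat m) i j → (A · B) i j ≡ (A ℚMat.⊗ B) i j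
·≡⊗ A B i j = ΣF≡sum (λ k → A i k * B k j)

if≡*indicator : ∀ b X → (if b then X else 0ℚ) ≡ X * ℤtoℚ (when b (+ 1))
if≡*indicator true  X = sym (ℚP.*-identityʳ X)
if≡*indicator false X = sym (ℚP.*-zeroʳ X)

lemma3p4 : (m : ℕ) (x : Fin m → ℕ)
    → (∀ i → 0 < x i)
    → Injective _≡_ _≡_ x
    → GcdClosed x
    → (∀ i j → x i ∣ x j → i ≤F j)
    → (V : Mat m)
    → (∀ i j → (gcdMat x · V) i j ≡ I i j)
    → (∀ i j → (V · gcdMat x) i j ≡ I i j)
    → (n q : Fin m)
    → ΣF (λ j → if does (x n ∣? x j) then (lcmMat x · V) q j else 0ℚ)
    ≡ ΣF (λ s → ℕtoℚ (lcm (x q) (x s)) * (ℤtoℚ (c x s n) ÷ℕ α x n))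
lemma3p4 m x pos inj closed _ V _ V·G≡I n q = begin
  ΣF (λ j → if does (x n ∣? x j) then (lcmMat x · V) q j else 0ℚ)
    ≡⟨ ΣF≡sum {m} _ ⟩
  ℚSum.sum (λ j → if does (x n ∣? x j) then (lcmMat x · V) q j else 0ℚ)
    ≡⟨ ℚSum.sum-cong-≗ (λ j → trans (if≡*indicator (does (x n ∣? x j)) _) (cong (_* ζₙ j) (·≡⊗ (lcmMat x) V q j))) ⟩
  ((lcmMat x ℚMat.⊗ V) ℚMat.⊛ ζₙ) q        ≡⟨ ℚMat.⊛-assoc (lcmMat x) V ζₙ q ⟨
  (lcmMat x ℚMat.⊛ (V ℚMat.⊛ ζₙ)) q        ≡⟨ ℚMat.⊛-cong {A = lcmMat x} (λ _ _ → refl) U·ζₙ≡w q ⟩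
  (lcmMat x ℚMat.⊛ solution n) q           ≡⟨ ΣF≡sum {m} _ ⟨
  ΣF (λ s → ℕtoℚ (lcm (x q) (x s)) * (ℤtoℚ (c x s n) ÷ℕ α x n)) ∎
  where
  open ≡-Reasoning
  open GcdClosedSet x pos inj closed using (ζ; solution; gcdMat⊛solution)
  ζₙ : Fin m → ℚ
  ζₙ j = ℤtoℚ (ζ n j)
  U·ζₙ≡w : ∀ k → (V ℚMat.⊛ ζₙ) k ≡ solution n k
  U·ζₙ≡w = ℚMat.left-inverse-solves V (gcdMat x) (solution n) ζₙ
    (λ i j → trans (sym (·≡⊗ V (gcdMat x) i j)) (V·G≡I i j)) (gcdMat⊛solution n)
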